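{- Let $X$ be a finite pure $d$-dimensional simplicial complex. Then for every $1\le i<d$ the bipartiteness ratio of the $i$-graph satisfies $$\beta(G_i(X))\ge\frac{1}{i+2}.$$
   Context: A simplicial complex $X$ on a finite vertex set is a family of subsets (faces) closed under taking subsets. A face $\sigma$ has dimension $|\sigma|-1$; $X(i)$ is the set of $i$-faces. $X$ is $d$-dimensional if its maximal face dimension is $d$, pure if every face lies in a $d$-face. $\deg(\sigma)$ is the number of $d$-faces containing $\sigma$. The $i$-graph $G_i(X)$ is the multigraph with vertex set $X(i)$ having, for each pair of distinct $\sigma,\sigma'\in X(i)$ with $\sigma\cup\sigma'\in X(i+1)$, exactly $\deg(\sigma\cup\sigma')$ parallel edges between $\sigma$ and $\sigma'$. For a multigraph $G=(V,E)$: $\deg(v)$ is the number of edges at $v$, $\mathrm{vol}(S)=\sum_{v\in S}\deg(v)$, $E(S,\bar S)$ is the multiset of edges with exactly one endpoint in $S$, and $E(T)$ is the multiset of edges with both endpoints in $T$. For $\emptyset\ne S\subseteq V$ and a partition $S=S_1\sqcup S_2$, $\beta(S,S_1,S_2)=\big(|E(S,\bar S)|+2(|E(S_1)|+|E(S_2)|)\big)/\mathrm{vol}(S)$, and $\beta(G)$ is the minimum of $\beta(S,S_1,S_2)$ over all such triples. -}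

module Defs where

open import Data.Bool using (Bool; true; false; _∧_; _∨_; not; if_then_else_)
open import Data.Bool.Properties using () renaming (_≟_ to _≟B_)
open import Data.Nat using (ℕ; zero; suc; _+_; _*_; _≤_; _≡ᵇ_)
open import Data.List using (List; []; _∷_; map; _++_; length; filterᵇ)
open import Data.Nat.ListAction using (sum)
open import Data.List.Membership.Propositional using (_∈_)
open import Data.Product using (Σ; _×_; _,_; proj₁; proj₂; ∃-syntax)
open import Data.Vec using (Vec; []; _∷_)
open import Data.Vec.Properties using (≡-dec)
open import Data.Fin.Subset using (Subset; _⊆_; _∪_; ∣_∣; inside; outside)
open import Data.Fin.Subset.Properties using (_⊆?_)
open import Relation.Nullary.Decidable using (⌊_⌋)
open import Relation.Binary.PropositionalEquality using (_≡_)

sumL : {A : Set} → List A → (A → ℕ) → ℕ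
sumL xs f = sum (map f xs)

upairs : {A : Set} → List A → List (A × A)
upairs []       = []
upairs (x ∷ xs) = map (x ,_) xs ++ upairs xs

allSubsets : (n : ℕ) → List (Subset n)
allSubsets zero    = [] ∷ []
allSubsets (suc n) = map (outside ∷_) (allSubsets n) ++ map (inside ∷_) (allSubsets n)

-- Finite multigraphs: vertex list V (without repetitions) and an edge
-- multiplicity function μ (μ v w = number of parallel edges between v, w).

record MultiGraph : Set₁ where
  field
    Vtx : Set
    V   : List Vtx
    μ   : Vtx → Vtx → ℕ

module _ (G : MultiGraph) where
  open MultiGraph G

  gdeg : Vtx → ℕ
  gdeg v = sumL V (μ v)

  vol : (Vtx → Bool) → ℕ
  vol S = sumL (filterᵇ S V) gdeg

  cutSize : (Vtx → Bool) → ℕ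
  cutSize S = sumL (filterᵇ S V) (λ v → sumL (filterᵇ (λ w → not (S w)) V) (μ v))

  innerSize : (Vtx → Bool) → ℕ
  innerSize T = sumL (upairs (filterᵇ T V)) (λ p → μ (proj₁ p) (proj₂ p))

  IsSplit : (S S₁ S₂ : Vtx → Bool) → Set
  IsSplit S S₁ S₂ =
    (∃[ v ] (v ∈ V × S v ≡ true)) ×
    ((v : Vtx) → S v ≡ (S₁ v ∨ S₂ v)) ×
    ((v : Vtx) → (S₁ v ∧ S₂ v) ≡ false)

  βnum : (S S₁ S₂ : Vtx → Bool) → ℕ
  βnum S S₁ S₂ = cutSize S + 2 * (innerSize S₁ + innerSize S₂)

  -- β(G) ≥ p / q, i.e. β(S,S₁,S₂) = βnum / vol(S) ≥ p / q for every triple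
  -- (the minimum over the finitely many triples is ≥ p/q), cross-multiplied.
  βAtLeast : (p q : ℕ) → Set
  βAtLeast p q = (S S₁ S₂ : Vtx → Bool) → IsSplit S S₁ S₂ →
                 p * vol S ≤ q * βnum S S₁ S₂

IsSimplicialComplex : {n : ℕ} → (Subset n → Bool) → Set
IsSimplicialComplex {n} X = (σ τ : Subset n) → τ ⊆ σ → X σ ≡ true → X τ ≡ true

IsPureDim : {n : ℕ} → (Subset n → Bool) → ℕ → Set
IsPureDim {n} X d =
  ((σ : Subset n) → X σ ≡ true → ∣ σ ∣ ≤ suc d) ×
  (∃[ σ ] (X σ ≡ true × ∣ σ ∣ ≡ suc d)) ×
  ((σ : Subset n) → X σ ≡ true → ∃[ τ ] (X τ ≡ true × ∣ τ ∣ ≡ suc d × σ ⊆ τ))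

isFaceDim : {n : ℕ} → (Subset n → Bool) → ℕ → Subset n → Bool
isFaceDim X k σ = X σ ∧ (∣ σ ∣ ≡ᵇ suc k)

facesDim : {n : ℕ} → (Subset n → Bool) → ℕ → List (Subset n)
facesDim {n} X k = filterᵇ (isFaceDim X k) (allSubsets n)

faceDeg : {n : ℕ} → (Subset n → Bool) → ℕ → Subset n → ℕ
faceDeg {n} X d τ = length (filterᵇ (λ σ → ⌊ τ ⊆? σ ⌋) (facesDim X d))

iGraphMult : {n : ℕ} → (Subset n → Bool) → (d i : ℕ) → Subset n → Subset n → ℕ
iGraphMult X d i σ σ' =
  if ⌊ ≡-dec _≟B_ σ σ' ⌋ then 0
  else (if isFaceDim X (suc i) (σ ∪ σ') then faceDeg X d (σ ∪ σ') else 0)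

iGraph : {n : ℕ} → (Subset n → Bool) → (d i : ℕ) → MultiGraph
iGraph {n} X d i = record
  { Vtx = Subset n
  ; V   = facesDim X i
  ; μ   = iGraphMult X d i
  }

module Submission where

open import Defs
open import Data.Bool using (Bool; true; false; _∧_; _∨_; not; T; T?)
open import Data.Bool.Properties using (∧-comm; ∧-zeroʳ; ∧-identityʳ; T-≡; T-∧) renaming (_≟_ to _≟B_)
open import Data.Fin.Subset using (Subset; _⊆_; _∪_; ∣_∣; inside; outside)
open import Data.Fin.Subset.Properties
  using (_⊆?_; ∪-comm; drop-∷-⊆; p⊆q⇒∣p∣≤∣q∣; p⊆p∪q; q⊆p∪q; x∈p∪q⁻; ∣p∣≤∣p∪q∣)
open import Data.List using (List; []; _∷_; map; _++_; filterᵇ)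
open import Data.List.Membership.Propositional using (_∈_)
open import Data.List.Membership.Propositional.Properties using (∈-map⁺; ∈-++⁺ˡ; ∈-++⁺ʳ; ∈-filter⁻)
open import Data.List.Properties using (map-++; map-∘)
open import Data.List.Relation.Unary.All as All using (All)
open import Data.List.Relation.Unary.Any using (here; there)
open import Data.Nat using (ℕ; zero; suc; _+_; _*_; _≤_; _<_; _≡ᵇ_; _≤ᵇ_; z≤n; s≤s)
open import Data.Nat.Combinatorics using (_C_; nCk≡nC[n∸k]; nC1≡n; nCk+nC[k+1]≡[n+1]C[k+1])
open import Data.Nat.ListAction using (sum)
open import Data.Nat.ListAction.Properties using (sum-++)
open import Data.Nat.Properties
open import Algebra.Properties.CommutativeSemigroup +-commutativeSemigroup using (interchange; x∙yz≈y∙xz)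
open import Data.Product using (_×_; _,_; proj₁; proj₂)
open import Data.Sum using ([_,_]′)
open import Data.Vec using ([]; _∷_; here)
open import Data.Vec.Properties using (≡-dec)
open import Function.Base using (_∘_)
open import Function.Bundles using (Equivalence)
open import Relation.Binary.PropositionalEquality
open import Relation.Nullary using (yes; no)
open import Relation.Nullary.Decidable using (does; toWitness; dec-true; dec-false)
open import Relation.Nullary.Negation using (contradiction)

-- An edge ab of G_i(X) comes from the (i+1)-face a ∪ b and has multiplicity deg(a ∪ b).
-- The i other facets c of a ∪ b close i triangles abc, and all three edges of such a
-- triangle have that same multiplicity. Given S = S₁ ⊔ S₂, an ordered pair (a, b) with
-- a ∈ S either contributes to the numerator of β (b ∉ S, or a, b on the same side) or is
-- an S₁–S₂ pair, and vol(S) is the sum of both kinds. On every triangle the S₁–S₂ weight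
-- of ab is at most the counted weights of ac and bc together; since every pair lies in
-- exactly i triangles, summing gives S₁–S₂ weight ≤ 2 · numerator. Hence
-- vol(S) ≤ 3 · numerator, i.e. β(G_i(X)) ≥ 1/3 ≥ 1/(i+2).

private
  variable
    A B : Set

⟦_⟧ : Bool → ℕ
⟦ true ⟧  = 1
⟦ false ⟧ = 0

⟦∧⟧ : ∀ x y → ⟦ x ∧ y ⟧ ≡ ⟦ x ⟧ * ⟦ y ⟧
⟦∧⟧ true  y = sym (+-identityʳ ⟦ y ⟧)
⟦∧⟧ false y = refl

sumL-cong : ∀ (xs : List A) {f g : A → ℕ} → (∀ x → f x ≡ g x) → sumL xs f ≡ sumL xs g
sumL-cong []       f≗g = refl
sumL-cong (x ∷ xs) f≗g = cong₂ _+_ (f≗g x) (sumL-cong xs f≗g)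

sumL-cong-∈ : ∀ {xs : List A} {f g : A → ℕ} → (∀ {x} → x ∈ xs → f x ≡ g x) → sumL xs f ≡ sumL xs g
sumL-cong-∈ {xs = []}     f≗g = refl
sumL-cong-∈ {xs = x ∷ xs} f≗g = cong₂ _+_ (f≗g (here refl)) (sumL-cong-∈ (λ p → f≗g (there p)))

sumL-mono-∈ : ∀ {xs : List A} {f g : A → ℕ} → (∀ {x} → x ∈ xs → f x ≤ g x) → sumL xs f ≤ sumL xs g
sumL-mono-∈ {xs = []}     f≤g = z≤n
sumL-mono-∈ {xs = x ∷ xs} f≤g = +-mono-≤ (f≤g (here refl)) (sumL-mono-∈ (λ p → f≤g (there p)))

sumL-zero : ∀ (xs : List A) {f : A → ℕ} → (∀ x → f x ≡ 0) → sumL xs f ≡ 0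
sumL-zero []       f≗0 = refl
sumL-zero (x ∷ xs) f≗0 = cong₂ _+_ (f≗0 x) (sumL-zero xs f≗0)

sumL-+ : ∀ (xs : List A) (f g : A → ℕ) → sumL xs (λ x → f x + g x) ≡ sumL xs f + sumL xs g
sumL-+ []       f g = refl
sumL-+ (x ∷ xs) f g =
  trans (cong (f x + g x +_) (sumL-+ xs f g)) (interchange (f x) (g x) (sumL xs f) (sumL xs g))

sumL-*ˡ : ∀ (xs : List A) (k : ℕ) (f : A → ℕ) → sumL xs (λ x → k * f x) ≡ k * sumL xs f
sumL-*ˡ []       k f = sym (*-zeroʳ k)
sumL-*ˡ (x ∷ xs) k f = trans (cong (k * f x +_) (sumL-*ˡ xs k f)) (sym (*-distribˡ-+ k (f x) _))

sumL-*ʳ : ∀ (xs : List A) (f : A → ℕ) (k : ℕ) → sumL xs (λ x → f x * k) ≡ sumL xs f * k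
sumL-*ʳ xs f k = trans (sumL-cong xs (λ x → *-comm (f x) k)) (trans (sumL-*ˡ xs k f) (*-comm k _))

sumL-swap : ∀ (xs : List A) (ys : List B) (f : A → B → ℕ) →
            sumL xs (λ x → sumL ys (f x)) ≡ sumL ys (λ y → sumL xs (λ x → f x y))
sumL-swap []       ys f = sym (sumL-zero ys (λ _ → refl))
sumL-swap (x ∷ xs) ys f =
  trans (cong (sumL ys (f x) +_) (sumL-swap xs ys f)) (sym (sumL-+ ys (f x) _))

sumL-++ : ∀ (xs ys : List A) (f : A → ℕ) → sumL (xs ++ ys) f ≡ sumL xs f + sumL ys f
sumL-++ xs ys f = trans (cong sum (map-++ f xs ys)) (sum-++ (map f xs) (map f ys))

sumL-map : ∀ (h : B → A) (xs : List B) (f : A → ℕ) → sumL (map h xs) f ≡ sumL xs (λ x → f (h x))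
sumL-map h xs f = cong sum (sym (map-∘ xs))

sumL-filterᵇ : ∀ (P : A → Bool) (xs : List A) (f : A → ℕ) →
               sumL (filterᵇ P xs) f ≡ sumL xs (λ x → ⟦ P x ⟧ * f x)
sumL-filterᵇ P []       f = refl
sumL-filterᵇ P (x ∷ xs) f with P x
... | true  = cong₂ _+_ (sym (+-identityʳ (f x))) (sumL-filterᵇ P xs f)
... | false = sumL-filterᵇ P xs f

sumL-upairs : ∀ (f : A → A → ℕ) → (∀ x y → f x y ≡ f y x) → (∀ x → f x x ≡ 0) → ∀ xs →
              2 * sumL (upairs xs) (λ p → f (proj₁ p) (proj₂ p)) ≡ sumL xs (λ x → sumL xs (f x))
sumL-upairs f f-sym f-diag []       = refl
sumL-upairs {A = A} f f-sym f-diag (x ∷ xs) = begin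
  2 * sumL (map (x ,_) xs ++ upairs xs) F
    ≡⟨ cong (2 *_) (trans (sumL-++ (map (x ,_) xs) (upairs xs) F) (cong (_+ u) (sumL-map (x ,_) xs F))) ⟩
  2 * (a + u)
    ≡⟨ *-distribˡ-+ 2 a u ⟩
  2 * a + 2 * u
    ≡⟨ cong₂ _+_ (cong (a +_) (+-identityʳ a)) (sumL-upairs f f-sym f-diag xs) ⟩
  a + a + r
    ≡⟨ +-assoc a a r ⟩
  a + (a + r)
    ≡⟨ cong₂ _+_ (cong (_+ a) (f-diag x)) (cong (_+ r) (sumL-cong xs (λ y → f-sym y x))) ⟨
  f x x + a + (sumL xs (λ y → f y x) + r)
    ≡⟨ cong (f x x + a +_) (sumL-+ xs (λ y → f y x) (λ y → sumL xs (f y))) ⟨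
  f x x + a + sumL xs (λ y → f y x + sumL xs (f y)) ∎
  where
  open ≡-Reasoning
  F : A × A → ℕ
  F p = f (proj₁ p) (proj₂ p)
  a u r : ℕ
  a = sumL xs (f x)
  u = sumL (upairs xs) F
  r = sumL xs (λ y → sumL xs (f y))

∈-allSubsets : ∀ {n} (p : Subset n) → p ∈ allSubsets n
∈-allSubsets []          = here refl
∈-allSubsets (false ∷ p) = ∈-++⁺ˡ (∈-map⁺ (outside ∷_) (∈-allSubsets p))
∈-allSubsets (true ∷ p)  = ∈-++⁺ʳ (map (outside ∷_) (allSubsets _)) (∈-map⁺ (inside ∷_) (∈-allSubsets p))

sumL-allSubsets-suc : ∀ n (g : Subset (suc n) → ℕ) →
  sumL (allSubsets (suc n)) g ≡
  sumL (allSubsets n) (λ p → g (outside ∷ p)) + sumL (allSubsets n) (λ p → g (inside ∷ p))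
sumL-allSubsets-suc n g = begin
  sumL (map (outside ∷_) (allSubsets n) ++ map (inside ∷_) (allSubsets n)) g
    ≡⟨ sumL-++ (map (outside ∷_) (allSubsets n)) _ g ⟩
  sumL (map (outside ∷_) (allSubsets n)) g + sumL (map (inside ∷_) (allSubsets n)) g
    ≡⟨ cong₂ _+_ (sumL-map (outside ∷_) (allSubsets n) g) (sumL-map (inside ∷_) (allSubsets n) g) ⟩
  sumL (allSubsets n) (λ p → g (outside ∷ p)) + sumL (allSubsets n) (λ p → g (inside ∷ p)) ∎
  where open ≡-Reasoning

-- Decided with `does` rather than `⌊_⌋`, which is stuck under `map′` and `_×-dec_` and
-- so would not compute along `allSubsets`.
_=ˢ_ : ∀ {n} → Subset n → Subset n → Bool
p =ˢ q = does (≡-dec _≟B_ p q)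

_⊆ᵇ_ : ∀ {n} → Subset n → Subset n → Bool
p ⊆ᵇ q = does (p ⊆? q)

count-allSubsets-remove : ∀ n (P : Subset n → Bool) (a : Subset n) →
  sumL (allSubsets n) (λ p → ⟦ P p ⟧) ≡ ⟦ P a ⟧ + sumL (allSubsets n) (λ p → ⟦ not (p =ˢ a) ∧ P p ⟧)
count-allSubsets-remove zero    P []      = refl
count-allSubsets-remove (suc n) P (s ∷ a) = begin
  sumL (allSubsets (suc n)) (λ p → ⟦ P p ⟧)
    ≡⟨ sumL-allSubsets-suc n _ ⟩
  count (outside ∷_) + count (inside ∷_)
    ≡⟨ remove-head s ⟩
  ⟦ P (s ∷ a) ⟧ + (count′ s (outside ∷_) + count′ s (inside ∷_))
    ≡⟨ cong (⟦ P (s ∷ a) ⟧ +_) (sumL-allSubsets-suc n _) ⟨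
  ⟦ P (s ∷ a) ⟧ + sumL (allSubsets (suc n)) (λ p → ⟦ not (p =ˢ (s ∷ a)) ∧ P p ⟧) ∎
  where
  open ≡-Reasoning
  count : (Subset n → Subset (suc n)) → ℕ
  count h = sumL (allSubsets n) (λ p → ⟦ P (h p) ⟧)
  count′ : Bool → (Subset n → Subset (suc n)) → ℕ
  count′ s h = sumL (allSubsets n) (λ p → ⟦ not (h p =ˢ (s ∷ a)) ∧ P (h p) ⟧)
  remove-head : ∀ s → count (outside ∷_) + count (inside ∷_) ≡
                      ⟦ P (s ∷ a) ⟧ + (count′ s (outside ∷_) + count′ s (inside ∷_))
  remove-head false =
    trans (cong (_+ count (inside ∷_)) (count-allSubsets-remove n (λ p → P (outside ∷ p)) a))
          (+-assoc ⟦ P (outside ∷ a) ⟧ _ _)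
  remove-head true  =
    trans (cong (count (outside ∷_) +_) (count-allSubsets-remove n (λ p → P (inside ∷ p)) a))
          (x∙yz≈y∙xz (count (outside ∷_)) ⟦ P (inside ∷ a) ⟧ _)

count-⊆-of-size : ∀ n (τ : Subset n) k →
                  sumL (allSubsets n) (λ p → ⟦ p ⊆ᵇ τ ∧ (∣ p ∣ ≡ᵇ k) ⟧) ≡ ∣ τ ∣ C k
count-⊆-of-size zero    []      zero    = refl
count-⊆-of-size zero    []      (suc k) = refl
count-⊆-of-size (suc n) (s ∷ τ) k       = trans (sumL-allSubsets-suc n _) (split s k)
  where
  count : (Subset n → Subset (suc n)) → Bool → ℕ → ℕ
  count h s k = sumL (allSubsets n) (λ p → ⟦ h p ⊆ᵇ (s ∷ τ) ∧ (∣ h p ∣ ≡ᵇ k) ⟧)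
  split : ∀ s k → count (outside ∷_) s k + count (inside ∷_) s k ≡ ∣ s ∷ τ ∣ C k
  split false k       = trans (cong₂ _+_ (count-⊆-of-size n τ k) (sumL-zero (allSubsets n) (λ _ → refl)))
                              (+-identityʳ _)
  split true  zero    = cong₂ _+_ (count-⊆-of-size n τ 0)
                              (sumL-zero (allSubsets n) (λ p → cong ⟦_⟧ (∧-zeroʳ (p ⊆ᵇ τ))))
  split true  (suc k) = trans (cong₂ _+_ (count-⊆-of-size n τ (suc k)) (count-⊆-of-size n τ k))
                              (trans (+-comm (∣ τ ∣ C suc k) _) (nCk+nC[k+1]≡[n+1]C[k+1] ∣ τ ∣ k))

[1+n]Cn≡1+n : ∀ n → suc n C n ≡ suc n
[1+n]Cn≡1+n n = trans (nCk≡nC[n∸k] (n≤1+n n)) (trans (cong (suc n C_) (m+n∸n≡m 1 n)) (nC1≡n (suc n)))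

p⊆q∧∣q∣≤∣p∣⇒p≡q : ∀ {n} {p q : Subset n} → p ⊆ q → ∣ q ∣ ≤ ∣ p ∣ → p ≡ q
p⊆q∧∣q∣≤∣p∣⇒p≡q {p = []}          {[]}          _   _             = refl
p⊆q∧∣q∣≤∣p∣⇒p≡q {p = outside ∷ p} {outside ∷ q} p⊆q ∣q∣≤∣p∣       =
  cong (outside ∷_) (p⊆q∧∣q∣≤∣p∣⇒p≡q (drop-∷-⊆ p⊆q) ∣q∣≤∣p∣)
p⊆q∧∣q∣≤∣p∣⇒p≡q {p = outside ∷ p} {inside ∷ q}  p⊆q ∣q∣<∣p∣       =
  contradiction (p⊆q⇒∣p∣≤∣q∣ (drop-∷-⊆ p⊆q)) (<⇒≱ ∣q∣<∣p∣)
p⊆q∧∣q∣≤∣p∣⇒p≡q {p = inside ∷ p}  {outside ∷ q} p⊆q _             = contradiction (p⊆q here) λ ()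
p⊆q∧∣q∣≤∣p∣⇒p≡q {p = inside ∷ p}  {inside ∷ q}  p⊆q (s≤s ∣q∣≤∣p∣) =
  cong (inside ∷_) (p⊆q∧∣q∣≤∣p∣⇒p≡q (drop-∷-⊆ p⊆q) ∣q∣≤∣p∣)

facet∪facet≡face : ∀ {n k} {a c τ : Subset n} → ∣ a ∣ ≡ suc k → ∣ c ∣ ≡ suc k → ∣ τ ∣ ≡ suc (suc k) →
                   a ⊆ τ → c ⊆ τ → c ≢ a → a ∪ c ≡ τ
facet∪facet≡face {a = a} {c} {τ} ∣a∣ ∣c∣ ∣τ∣ a⊆τ c⊆τ c≢a =
  p⊆q∧∣q∣≤∣p∣⇒p≡q a∪c⊆τ (subst (_≤ ∣ a ∪ c ∣) (sym ∣τ∣) (subst (_< ∣ a ∪ c ∣) ∣a∣ ∣a∣<∣a∪c∣))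
  where
  a∪c⊆τ : a ∪ c ⊆ τ
  a∪c⊆τ x∈a∪c = [ a⊆τ , c⊆τ ]′ (x∈p∪q⁻ a c x∈a∪c)
  ∣a∣<∣a∪c∣ : ∣ a ∣ < ∣ a ∪ c ∣
  ∣a∣<∣a∪c∣ = ≤∧≢⇒< (∣p∣≤∣p∪q∣ a c) λ ∣a∣≡∣a∪c∣ →
    let a≡a∪c = p⊆q∧∣q∣≤∣p∣⇒p≡q (p⊆p∪q c) (≤-reflexive (sym ∣a∣≡∣a∪c∣))
    in c≢a (p⊆q∧∣q∣≤∣p∣⇒p≡q (subst (c ⊆_) (sym a≡a∪c) (q⊆p∪q a c)) (≤-reflexive (trans ∣a∣ (sym ∣c∣))))

-- A vertex v is coloured (v ∈ S₁ , v ∈ S₂). For an ordered pair, `counted` is its weight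
-- in the numerator of β (a pair inside S₁ or S₂ is met from both ends, which accounts for
-- the factor 2 there) and `crossing` its weight as an S₁–S₂ pair.
counted crossing : Bool × Bool → Bool × Bool → ℕ
counted  (x₁ , x₂) (y₁ , y₂) = ⟦ (x₁ ∨ x₂) ∧ not (y₁ ∨ y₂) ⟧ + (⟦ x₁ ∧ y₁ ⟧ + ⟦ x₂ ∧ y₂ ⟧)
crossing (x₁ , x₂) (y₁ , y₂) = ⟦ x₁ ∧ y₂ ⟧ + ⟦ x₂ ∧ y₁ ⟧

⟦∨⟧≡counted+crossing : ∀ x₁ x₂ y₁ y₂ → x₁ ∧ x₂ ≡ false → y₁ ∧ y₂ ≡ false →
                       ⟦ x₁ ∨ x₂ ⟧ ≡ counted (x₁ , x₂) (y₁ , y₂) + crossing (x₁ , x₂) (y₁ , y₂)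
⟦∨⟧≡counted+crossing false false _     _     _  _  = refl
⟦∨⟧≡counted+crossing true  true  _     _     () _
⟦∨⟧≡counted+crossing _     _     true  true  _  ()
⟦∨⟧≡counted+crossing true  false false false _  _  = refl
⟦∨⟧≡counted+crossing true  false true  false _  _  = refl
⟦∨⟧≡counted+crossing true  false false true  _  _  = refl
⟦∨⟧≡counted+crossing false true  false false _  _  = refl
⟦∨⟧≡counted+crossing false true  true  false _  _  = refl
⟦∨⟧≡counted+crossing false true  false true  _  _  = refl

-- If z ∉ S₁ ∪ S₂ the cut terms pay for a crossing pair xy, if z ∈ Sⱼ the Sⱼ-terms do;
-- the 2⁶ cases are checked by evaluation.
crossing≤counted+counted : ∀ x y z → crossing x y ≤ counted x z + counted y z
crossing≤counted+counted (x₁ , x₂) (y₁ , y₂) (z₁ , z₂) =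
  ≤ᵇ⇒≤ _ _ (All.lookup table (∈-allSubsets (x₁ ∷ x₂ ∷ y₁ ∷ y₂ ∷ z₁ ∷ z₂ ∷ [])))
  where
  holds : Subset 6 → Bool
  holds (x₁ ∷ x₂ ∷ y₁ ∷ y₂ ∷ z₁ ∷ z₂ ∷ []) =
    crossing (x₁ , x₂) (y₁ , y₂) ≤ᵇ counted (x₁ , x₂) (z₁ , z₂) + counted (y₁ , y₂) (z₁ , z₂)
  table : All (λ v → T (holds v)) (allSubsets 6)
  table = toWitness {a? = All.all? (λ v → T? (holds v)) (allSubsets 6)} _

module _ (G : MultiGraph) where
  open MultiGraph G

  pairSum : (Vtx → Vtx → ℕ) → ℕ
  pairSum h = sumL V (λ a → sumL V (λ b → h a b * μ a b))

  pairSum-cong : ∀ {h h′ : Vtx → Vtx → ℕ} → (∀ a b → h a b ≡ h′ a b) → pairSum h ≡ pairSum h′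
  pairSum-cong h≗h′ = sumL-cong V (λ a → sumL-cong V (λ b → cong (_* μ a b) (h≗h′ a b)))

  pairSum-+ : ∀ (h h′ : Vtx → Vtx → ℕ) → pairSum (λ a b → h a b + h′ a b) ≡ pairSum h + pairSum h′
  pairSum-+ h h′ = trans
    (sumL-cong V (λ a → trans (sumL-cong V (λ b → *-distribʳ-+ (μ a b) (h a b) (h′ a b)))
                              (sumL-+ V (λ b → h a b * μ a b) (λ b → h′ a b * μ a b))))
    (sumL-+ V _ _)

  vol≡pairSum : ∀ S → vol G S ≡ pairSum (λ a _ → ⟦ S a ⟧)
  vol≡pairSum S = trans (sumL-filterᵇ S V (gdeg G)) (sumL-cong V (λ a → sym (sumL-*ˡ V ⟦ S a ⟧ (μ a))))

  sumL-filterᵇ² : ∀ (P Q : Vtx → Bool) →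
                  sumL (filterᵇ P V) (λ a → sumL (filterᵇ Q V) (μ a)) ≡ pairSum (λ a b → ⟦ P a ∧ Q b ⟧)
  sumL-filterᵇ² P Q = trans (sumL-filterᵇ P V _) (sumL-cong V λ a → begin
    ⟦ P a ⟧ * sumL (filterᵇ Q V) (μ a)
      ≡⟨ cong (⟦ P a ⟧ *_) (sumL-filterᵇ Q V (μ a)) ⟩
    ⟦ P a ⟧ * sumL V (λ b → ⟦ Q b ⟧ * μ a b)
      ≡⟨ sumL-*ˡ V ⟦ P a ⟧ _ ⟨
    sumL V (λ b → ⟦ P a ⟧ * (⟦ Q b ⟧ * μ a b))
      ≡⟨ sumL-cong V (λ b → trans (cong (_* μ a b) (⟦∧⟧ (P a) (Q b))) (*-assoc ⟦ P a ⟧ ⟦ Q b ⟧ (μ a b))) ⟨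
    sumL V (λ b → ⟦ P a ∧ Q b ⟧ * μ a b) ∎)
    where open ≡-Reasoning

  module _ (μ-sym : ∀ a b → μ a b ≡ μ b a) (μ-diag : ∀ a → μ a a ≡ 0) where

    βnum≡pairSum : ∀ S S₁ S₂ → βnum G S S₁ S₂ ≡
                   pairSum (λ a b → ⟦ S a ∧ not (S b) ⟧ + (⟦ S₁ a ∧ S₁ b ⟧ + ⟦ S₂ a ∧ S₂ b ⟧))
    βnum≡pairSum S S₁ S₂ = begin
      cutSize G S + 2 * (innerSize G S₁ + innerSize G S₂)
        ≡⟨ cong (cutSize G S +_) (*-distribˡ-+ 2 (innerSize G S₁) (innerSize G S₂)) ⟩
      cutSize G S + (2 * innerSize G S₁ + 2 * innerSize G S₂)
        ≡⟨ cong₂ _+_ (sumL-filterᵇ² S (λ b → not (S b))) (cong₂ _+_ (inner S₁) (inner S₂)) ⟩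
      pairSum cut + (pairSum (within S₁) + pairSum (within S₂))
        ≡⟨ cong (pairSum cut +_) (pairSum-+ (within S₁) (within S₂)) ⟨
      pairSum cut + pairSum (λ a b → within S₁ a b + within S₂ a b)
        ≡⟨ pairSum-+ cut _ ⟨
      pairSum (λ a b → cut a b + (within S₁ a b + within S₂ a b)) ∎
      where
      open ≡-Reasoning
      cut : Vtx → Vtx → ℕ
      cut a b = ⟦ S a ∧ not (S b) ⟧
      within : (Vtx → Bool) → Vtx → Vtx → ℕ
      within T a b = ⟦ T a ∧ T b ⟧
      inner : ∀ T → 2 * innerSize G T ≡ pairSum (within T)
      inner T = trans (sumL-upairs μ μ-sym μ-diag (filterᵇ T V)) (sumL-filterᵇ² T T)

record TriangleCover (G : MultiGraph) (k : ℕ) : Set where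
  open MultiGraph G
  field
    completes   : Vtx → Vtx → Vtx → Bool
    completions : ∀ {a b} → a ∈ V → b ∈ V → μ a b ≢ 0 → sumL V (λ c → ⟦ completes a b c ⟧) ≡ k
    rotate      : ∀ {a b c} → a ∈ V → b ∈ V → c ∈ V → μ a b ≢ 0 → completes a b c ≡ true →
                  (completes a c b ≡ true × μ a c ≡ μ a b) × (completes b c a ≡ true × μ b c ≡ μ a b)

module _ {G : MultiGraph} {k : ℕ} (cover : TriangleCover G k) where
  open MultiGraph G
  open TriangleCover cover

  private
    Σ³ : (Vtx → Vtx → Vtx → ℕ) → ℕ
    Σ³ F = sumL V λ a → sumL V λ b → sumL V λ c → F a b c

    Σ³-+ : ∀ F F′ → Σ³ (λ a b c → F a b c + F′ a b c) ≡ Σ³ F + Σ³ F′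
    Σ³-+ F F′ = trans
      (sumL-cong V λ a → trans (sumL-cong V λ b → sumL-+ V (F a b) (F′ a b)) (sumL-+ V _ _))
      (sumL-+ V _ _)

    Σ³-swap : ∀ F → Σ³ (λ a b c → F a c b) ≡ Σ³ F
    Σ³-swap F = sumL-cong V λ a → sumL-swap V V (λ b c → F a c b)

    Σ³-rotate : ∀ F → Σ³ (λ a b c → F b c a) ≡ Σ³ F
    Σ³-rotate F = trans (sumL-swap V V (λ a b → sumL V λ c → F b c a))
                        (sumL-cong V λ b → sumL-swap V V (λ a c → F b c a))

  triangleSum : (Vtx → Vtx → ℕ) → ℕ
  triangleSum h = Σ³ λ a b c → ⟦ completes a b c ⟧ * (h a b * μ a b)

  triangleSum≡k*pairSum : ∀ h → triangleSum h ≡ k * pairSum G h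
  triangleSum≡k*pairSum h =
    trans (sumL-cong-∈ λ a∈V → trans (sumL-cong-∈ λ b∈V → completionsSum a∈V b∈V) (sumL-*ˡ V k _))
          (sumL-*ˡ V k _)
    where
    completionsSum : ∀ {a b} → a ∈ V → b ∈ V →
                     sumL V (λ c → ⟦ completes a b c ⟧ * (h a b * μ a b)) ≡ k * (h a b * μ a b)
    completionsSum {a} {b} a∈V b∈V with μ a b ≟ 0
    ... | yes μ≡0 rewrite μ≡0 | *-zeroʳ (h a b) | *-zeroʳ k =
      sumL-zero V (λ c → *-zeroʳ ⟦ completes a b c ⟧)
    ... | no  μ≢0 = trans (sumL-*ʳ V _ _) (cong (_* (h a b * μ a b)) (completions a∈V b∈V μ≢0))

  pairSum-≤-triangles : ∀ (f g : Vtx → Vtx → ℕ) → (∀ a b c → f a b ≤ g a c + g b c) →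
                        k * pairSum G f ≤ k * (2 * pairSum G g)
  pairSum-≤-triangles f g f≤g+g = begin
    k * pairSum G f
      ≡⟨ triangleSum≡k*pairSum f ⟨
    triangleSum f
      ≤⟨ sumL-mono-∈ (λ a∈V → sumL-mono-∈ λ b∈V → sumL-mono-∈ λ c∈V → triangle-step a∈V b∈V c∈V) ⟩
    Σ³ (λ a b c → via a c b + via b c a)
      ≡⟨ Σ³-+ (λ a b c → via a c b) (λ a b c → via b c a) ⟩
    Σ³ (λ a b c → via a c b) + Σ³ (λ a b c → via b c a)
      ≡⟨ cong₂ _+_ (Σ³-swap via) (Σ³-rotate via) ⟩
    triangleSum g + triangleSum g
      ≡⟨ cong₂ _+_ (triangleSum≡k*pairSum g) (triangleSum≡k*pairSum g) ⟩
    k * pairSum G g + k * pairSum G g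
      ≡⟨ *-distribˡ-+ k (pairSum G g) _ ⟨
    k * (pairSum G g + pairSum G g)
      ≡⟨ cong (λ m → k * (pairSum G g + m)) (+-identityʳ _) ⟨
    k * (2 * pairSum G g) ∎
    where
    open ≤-Reasoning
    via : Vtx → Vtx → Vtx → ℕ
    via a b c = ⟦ completes a b c ⟧ * (g a b * μ a b)
    triangle-step : ∀ {a b c} → a ∈ V → b ∈ V → c ∈ V →
                    ⟦ completes a b c ⟧ * (f a b * μ a b) ≤ via a c b + via b c a
    triangle-step {a} {b} {c} a∈V b∈V c∈V with completes a b c in abc | μ a b ≟ 0
    ... | false | _       = z≤n
    ... | true  | yes μ≡0 =
      ≤-trans (≤-reflexive (trans (+-identityʳ _) (trans (cong (f a b *_) μ≡0) (*-zeroʳ (f a b))))) z≤n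
    ... | true  | no  μ≢0 with rotate a∈V b∈V c∈V μ≢0 abc
    ...   | (acb , μac≡μab) , (bca , μbc≡μab) rewrite acb | bca | μac≡μab | μbc≡μab = begin
      1 * (f a b * μ a b)
        ≡⟨ *-identityˡ _ ⟩
      f a b * μ a b
        ≤⟨ *-monoˡ-≤ (μ a b) (f≤g+g a b c) ⟩
      (g a c + g b c) * μ a b
        ≡⟨ *-distribʳ-+ (μ a b) (g a c) (g b c) ⟩
      g a c * μ a b + g b c * μ a b
        ≡⟨ cong₂ _+_ (*-identityˡ (g a c * μ a b)) (*-identityˡ (g b c * μ a b)) ⟨
      1 * (g a c * μ a b) + 1 * (g b c * μ a b) ∎

βAtLeast-1/3 : ∀ {G : MultiGraph} {k} → let open MultiGraph G in
               (∀ a b → μ a b ≡ μ b a) → (∀ a → μ a a ≡ 0) → TriangleCover G (suc k) → βAtLeast G 1 3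
βAtLeast-1/3 {G} {k} μ-sym μ-diag cover S S₁ S₂ (_ , S≡S₁∨S₂ , S₁∧S₂≡false) = begin
  1 * vol G S                                       ≡⟨ *-identityˡ (vol G S) ⟩
  vol G S                                           ≡⟨ vol≡pairSum G S ⟩
  pairSum G (λ a _ → ⟦ S a ⟧)                       ≡⟨ pairSum-cong G vol-split ⟩
  pairSum G (λ a b → counted′ a b + crossing′ a b)  ≡⟨ pairSum-+ G counted′ crossing′ ⟩
  pairSum G counted′ + pairSum G crossing′          ≤⟨ +-monoʳ-≤ (pairSum G counted′) crossing≤2counted ⟩
  3 * pairSum G counted′                            ≡⟨ cong (3 *_) (pairSum-cong G βnum-split) ⟨
  3 * pairSum G (λ a b → ⟦ S a ∧ not (S b) ⟧ + (⟦ S₁ a ∧ S₁ b ⟧ + ⟦ S₂ a ∧ S₂ b ⟧))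
                                                  ≡⟨ cong (3 *_) (βnum≡pairSum G μ-sym μ-diag S S₁ S₂) ⟨
  3 * βnum G S S₁ S₂                                ∎
  where
  open MultiGraph G
  open ≤-Reasoning
  colour : Vtx → Bool × Bool
  colour v = S₁ v , S₂ v
  counted′ crossing′ : Vtx → Vtx → ℕ
  counted′  a b = counted  (colour a) (colour b)
  crossing′ a b = crossing (colour a) (colour b)
  vol-split : ∀ a b → ⟦ S a ⟧ ≡ counted′ a b + crossing′ a b
  vol-split a b = trans (cong ⟦_⟧ (S≡S₁∨S₂ a))
    (⟦∨⟧≡counted+crossing (S₁ a) (S₂ a) (S₁ b) (S₂ b) (S₁∧S₂≡false a) (S₁∧S₂≡false b))
  βnum-split : ∀ a b → ⟦ S a ∧ not (S b) ⟧ + (⟦ S₁ a ∧ S₁ b ⟧ + ⟦ S₂ a ∧ S₂ b ⟧) ≡ counted′ a b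
  βnum-split a b rewrite S≡S₁∨S₂ a | S≡S₁∨S₂ b = refl
  crossing≤2counted : pairSum G crossing′ ≤ 2 * pairSum G counted′
  crossing≤2counted = *-cancelˡ-≤ (suc k) (pairSum-≤-triangles cover crossing′ counted′
    (λ a b c → crossing≤counted+counted (colour a) (colour b) (colour c)))

βAtLeast-mono : ∀ (G : MultiGraph) {p q q′} → q ≤ q′ → βAtLeast G p q → βAtLeast G p q′
βAtLeast-mono G q≤q′ β≥p/q S S₁ S₂ split =
  ≤-trans (β≥p/q S S₁ S₂ split) (*-monoˡ-≤ (βnum G S S₁ S₂) q≤q′)

isFaceDim⁻ : ∀ {n} {X : Subset n → Bool} {k σ} → T (isFaceDim X k σ) → X σ ≡ true × ∣ σ ∣ ≡ suc k
isFaceDim⁻ {X = X} {k} {σ} σ∈X⟨k⟩ =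
  let Xσ , ∣σ∣≡ᵇ1+k = Equivalence.to (T-∧ {X σ}) σ∈X⟨k⟩ in Equivalence.to T-≡ Xσ , ≡ᵇ⇒≡ _ _ ∣σ∣≡ᵇ1+k

isFaceDim⁺ : ∀ {n} {X : Subset n → Bool} {k σ} → X σ ≡ true → ∣ σ ∣ ≡ suc k → isFaceDim X k σ ≡ true
isFaceDim⁺ {k = k} {σ} Xσ ∣σ∣ rewrite Xσ = Equivalence.to T-≡ (≡⇒≡ᵇ ∣ σ ∣ (suc k) ∣σ∣)

∈-facesDim⁻ : ∀ {n} {X : Subset n → Bool} {k σ} → σ ∈ facesDim X k → X σ ≡ true × ∣ σ ∣ ≡ suc k
∈-facesDim⁻ {n} {X} {k} {σ} σ∈ =
  isFaceDim⁻ {X = X} (proj₂ (∈-filter⁻ (λ ρ → T? (isFaceDim X k ρ)) {xs = allSubsets n} σ∈))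

thirdFacet : ∀ {n} → Subset n → Subset n → Subset n → Bool
thirdFacet a b c = c ⊆ᵇ (a ∪ b) ∧ not (c =ˢ a) ∧ not (c =ˢ b)

thirdFacet⁻ : ∀ {n} {a b c : Subset n} → thirdFacet a b c ≡ true → c ⊆ a ∪ b × c ≢ a × c ≢ b
thirdFacet⁻ {a = a} {b} {c} h with c ⊆? a ∪ b | ≡-dec _≟B_ c a | ≡-dec _≟B_ c b
... | yes c⊆a∪b | no c≢a | no c≢b = c⊆a∪b , c≢a , c≢b
... | no _      | _      | _      = contradiction h λ ()
... | yes _     | yes _  | _      = contradiction h λ ()
... | yes _     | no _   | yes _  = contradiction h λ ()

thirdFacet⁺ : ∀ {n} {a b c : Subset n} → c ⊆ a ∪ b → c ≢ a → c ≢ b → thirdFacet a b c ≡ true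
thirdFacet⁺ {a = a} {b} {c} c⊆a∪b c≢a c≢b
  rewrite dec-true (c ⊆? a ∪ b) c⊆a∪b
        | dec-false (≡-dec _≟B_ c a) c≢a
        | dec-false (≡-dec _≟B_ c b) c≢b = refl

module _ {n : ℕ} (X : Subset n → Bool) (d i : ℕ) where
  private
    μ : Subset n → Subset n → ℕ
    μ = iGraphMult X d i

  iGraphMult-sym : ∀ a b → μ a b ≡ μ b a
  iGraphMult-sym a b with ≡-dec _≟B_ a b | ≡-dec _≟B_ b a
  ... | yes _    | yes _   = refl
  ... | no _     | no _    rewrite ∪-comm a b = refl
  ... | yes refl | no b≢a  = contradiction refl b≢a
  ... | no a≢b   | yes refl = contradiction refl a≢b

  iGraphMult-diag : ∀ a → μ a a ≡ 0
  iGraphMult-diag a with ≡-dec _≟B_ a a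
  ... | yes _   = refl
  ... | no a≢a  = contradiction refl a≢a

  iGraphMult-adjacent : ∀ {a b} → μ a b ≢ 0 → a ≢ b × T (isFaceDim X (suc i) (a ∪ b))
  iGraphMult-adjacent {a} {b} μ≢0 with ≡-dec _≟B_ a b
  ... | yes _   = contradiction refl μ≢0
  ... | no a≢b with isFaceDim X (suc i) (a ∪ b)
  ...   | true  = a≢b , _
  ...   | false = contradiction refl μ≢0

  iGraphMult-∪ : ∀ {a b a′ b′} → a ≢ b → a′ ≢ b′ → a ∪ b ≡ a′ ∪ b′ → μ a b ≡ μ a′ b′
  iGraphMult-∪ {a} {b} {a′} {b′} a≢b a′≢b′ ∪≡∪ with ≡-dec _≟B_ a b | ≡-dec _≟B_ a′ b′
  ... | yes a≡b | _         = contradiction a≡b a≢b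
  ... | no _    | yes a′≡b′ = contradiction a′≡b′ a′≢b′
  ... | no _    | no _      rewrite ∪≡∪ = refl

-- a ∪ b has (i+2) C (i+1) = i+2 facets, all of them faces of X; two of them are a and b.
thirdFacets-count : ∀ {n} {X : Subset n → Bool} → IsSimplicialComplex X → ∀ {i} {a b : Subset n} →
                    a ∈ facesDim X i → b ∈ facesDim X i → a ≢ b → T (isFaceDim X (suc i) (a ∪ b)) →
                    sumL (facesDim X i) (λ c → ⟦ thirdFacet a b c ⟧) ≡ i
thirdFacets-count {n} {X} X-closed {i} {a} {b} a∈ b∈ a≢b a∪b∈X = suc-injective (suc-injective (begin
  suc (suc (sumL (facesDim X i) (λ c → ⟦ thirdFacet a b c ⟧)))
    ≡⟨ cong (suc ∘ suc) (trans
         (sumL-filterᵇ (isFaceDim X i) all (λ c → ⟦ thirdFacet a b c ⟧))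
         (sumL-cong all (λ ρ → sym (⟦∧⟧ (isFaceDim X i ρ) (thirdFacet a b ρ))))) ⟩
  suc (suc (sumL all (λ ρ → ⟦ isFaceDim X i ρ ∧ thirdFacet a b ρ ⟧)))
    ≡⟨ cong (suc ∘ suc) (sumL-cong all (λ ρ → cong ⟦_⟧ (third-facets-of-τ ρ))) ⟩
  suc (suc rest)
    ≡⟨ cong₂ (λ x y → x + (y + rest)) (facet (p⊆p∪q b) ∣a∣) facet′ ⟨
  ⟦ facetOfτ a ⟧ + (⟦ not (b =ˢ a) ∧ facetOfτ b ⟧ + rest)
    ≡⟨ cong (⟦ facetOfτ a ⟧ +_) (count-allSubsets-remove n _ b) ⟨
  ⟦ facetOfτ a ⟧ + sumL all (λ ρ → ⟦ not (ρ =ˢ a) ∧ facetOfτ ρ ⟧)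
    ≡⟨ count-allSubsets-remove n facetOfτ a ⟨
  sumL all (λ ρ → ⟦ facetOfτ ρ ⟧)
    ≡⟨ count-⊆-of-size n τ (suc i) ⟩
  ∣ τ ∣ C suc i
    ≡⟨ cong (_C suc i) ∣τ∣ ⟩
  suc (suc i) C suc i
    ≡⟨ [1+n]Cn≡1+n (suc i) ⟩
  suc (suc i) ∎))
  where
  open ≡-Reasoning
  all : List (Subset n)
  all = allSubsets n
  τ : Subset n
  τ = a ∪ b
  facetOfτ : Subset n → Bool
  facetOfτ = isFaceDim (_⊆ᵇ τ) i
  rest : ℕ
  rest = sumL all (λ ρ → ⟦ not (ρ =ˢ b) ∧ (not (ρ =ˢ a) ∧ facetOfτ ρ) ⟧)
  Xτ : X τ ≡ true
  Xτ = proj₁ (isFaceDim⁻ {X = X} a∪b∈X)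
  ∣τ∣ : ∣ τ ∣ ≡ suc (suc i)
  ∣τ∣ = proj₂ (isFaceDim⁻ {X = X} a∪b∈X)
  ∣a∣ : ∣ a ∣ ≡ suc i
  ∣a∣ = proj₂ (∈-facesDim⁻ {X = X} a∈)
  ∣b∣ : ∣ b ∣ ≡ suc i
  ∣b∣ = proj₂ (∈-facesDim⁻ {X = X} b∈)
  facet : ∀ {σ} → σ ⊆ τ → ∣ σ ∣ ≡ suc i → ⟦ facetOfτ σ ⟧ ≡ 1
  facet {σ} σ⊆τ ∣σ∣ = cong ⟦_⟧ (isFaceDim⁺ {X = _⊆ᵇ τ} {σ = σ} (dec-true (σ ⊆? τ) σ⊆τ) ∣σ∣)
  facet′ : ⟦ not (b =ˢ a) ∧ facetOfτ b ⟧ ≡ 1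
  facet′ rewrite dec-false (≡-dec _≟B_ b a) (λ b≡a → a≢b (sym b≡a)) = facet (q⊆p∪q a b) ∣b∣
  x∧[y∧z]≡z∧[y∧x] : ∀ x y z → x ∧ (y ∧ z) ≡ z ∧ (y ∧ x)
  x∧[y∧z]≡z∧[y∧x] true  y z = trans (∧-comm y z) (cong (z ∧_) (sym (∧-identityʳ y)))
  x∧[y∧z]≡z∧[y∧x] false y z = sym (trans (cong (z ∧_) (∧-zeroʳ y)) (∧-zeroʳ z))
  third-facets-of-τ : ∀ ρ → isFaceDim X i ρ ∧ thirdFacet a b ρ ≡
                            not (ρ =ˢ b) ∧ (not (ρ =ˢ a) ∧ facetOfτ ρ)
  third-facets-of-τ ρ with ρ ⊆? τ
  ... | yes ρ⊆τ rewrite X-closed τ ρ ρ⊆τ Xτ =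
    x∧[y∧z]≡z∧[y∧x] (∣ ρ ∣ ≡ᵇ suc i) (not (ρ =ˢ a)) (not (ρ =ˢ b))
  ... | no _    =
    trans (∧-zeroʳ _) (sym (trans (cong (not (ρ =ˢ b) ∧_) (∧-zeroʳ _)) (∧-zeroʳ _)))

iGraph-triangleCover : ∀ {n} {X : Subset n → Bool} → IsSimplicialComplex X → ∀ d i →
                       TriangleCover (iGraph X d i) i
iGraph-triangleCover {X = X} X-closed d i = record
  { completes   = thirdFacet
  ; completions = λ {a} {b} a∈ b∈ μ≢0 →
      let a≢b , a∪b∈X = iGraphMult-adjacent X d i {a} {b} μ≢0
      in  thirdFacets-count X-closed a∈ b∈ a≢b a∪b∈X
  ; rotate      = rotate
  }
  where
  rotate : ∀ {a b c} → a ∈ facesDim X i → b ∈ facesDim X i → c ∈ facesDim X i →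
           iGraphMult X d i a b ≢ 0 → thirdFacet a b c ≡ true →
           (thirdFacet a c b ≡ true × iGraphMult X d i a c ≡ iGraphMult X d i a b) ×
           (thirdFacet b c a ≡ true × iGraphMult X d i b c ≡ iGraphMult X d i a b)
  rotate {a} {b} {c} a∈ b∈ c∈ μ≢0 abc
    with iGraphMult-adjacent X d i {a} {b} μ≢0 | thirdFacet⁻ {a = a} {b} {c} abc
  ... | a≢b , a∪b∈X | c⊆a∪b , c≢a , c≢b =
    (thirdFacet⁺ (subst (b ⊆_) (sym a∪c≡a∪b) (q⊆p∪q a b)) (a≢b ∘ sym) (c≢b ∘ sym) ,
     iGraphMult-∪ X d i (c≢a ∘ sym) a≢b a∪c≡a∪b) ,
    (thirdFacet⁺ (subst (a ⊆_) (sym b∪c≡a∪b) (p⊆p∪q {p = a} b)) a≢b (c≢a ∘ sym) ,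
     iGraphMult-∪ X d i (c≢b ∘ sym) a≢b b∪c≡a∪b)
    where
    ∣a∪b∣ : ∣ a ∪ b ∣ ≡ suc (suc i)
    ∣a∪b∣ = proj₂ (isFaceDim⁻ {X = X} a∪b∈X)
    ∣a∣ : ∣ a ∣ ≡ suc i
    ∣a∣ = proj₂ (∈-facesDim⁻ {X = X} {σ = a} a∈)
    ∣b∣ : ∣ b ∣ ≡ suc i
    ∣b∣ = proj₂ (∈-facesDim⁻ {X = X} {σ = b} b∈)
    ∣c∣ : ∣ c ∣ ≡ suc i
    ∣c∣ = proj₂ (∈-facesDim⁻ {X = X} {σ = c} c∈)
    a∪c≡a∪b : a ∪ c ≡ a ∪ b
    a∪c≡a∪b = facet∪facet≡face ∣a∣ ∣c∣ ∣a∪b∣ (p⊆p∪q {p = a} b) c⊆a∪b c≢a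
    b∪c≡a∪b : b ∪ c ≡ a ∪ b
    b∪c≡a∪b = facet∪facet≡face ∣b∣ ∣c∣ ∣a∪b∣ (q⊆p∪q a b) c⊆a∪b c≢b

lemma3p5 : (n d : ℕ) (X : Subset n → Bool) →
           IsSimplicialComplex X → IsPureDim X d →
           (i : ℕ) → 1 ≤ i → i < d →
           βAtLeast (iGraph X d i) 1 (i + 2)
lemma3p5 n d X X-closed _ i@(suc _) 1≤i _ =
  βAtLeast-mono (iGraph X d i) {p = 1} (+-monoˡ-≤ 2 1≤i)
    (βAtLeast-1/3 (iGraphMult-sym X d i) (iGraphMult-diag X d i) (iGraph-triangleCover X-closed d i))
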